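{- For the Prism allied graph $\mathbb{D}^{t}_{n}$ with $n\ge 4$, $\operatorname{mdim}(\mathbb{D}^{t}_{n})\ge n+1$.
   Context: For an integer $n\ge 3$, the Prism allied graph $\mathbb{D}^{t}_{n}$ has vertex set $\{p_i,q_i,r_i,s_i : 1\le i\le n\}$ and edge set $\{p_iq_i,\ p_ip_{i+1},\ q_iq_{i+1},\ r_iq_i,\ r_iq_{i+1},\ r_is_i : 1\le i\le n\}$, with indices taken modulo $n$. For a connected graph $H$, $d_H(u,v)$ is the shortest-path distance, and for a vertex $x$ and an edge $e=uv$, $d_H(x,e)=\min\{d_H(x,u),d_H(x,v)\}$. A set $M\subseteq V(H)$ is a mixed metric generator of $H$ if for every two distinct elements $y_1,y_2\in V(H)\cup E(H)$ there is a vertex $z\in M$ with $d_H(z,y_1)\ne d_H(z,y_2)$. The mixed metric dimension $\operatorname{mdim}(H)$ is the minimum cardinality of a mixed metric generator of $H$. -}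

module Defs where

open import Data.Nat using (ℕ; zero; suc; _+_; _*_; _⊔_; _⊓_)
open import Data.Nat.DivMod using (_mod_)
open import Data.Fin using (Fin; toℕ)
open import Data.Fin.Properties using () renaming (_≟_ to _≟F_)
open import Data.Bool using (Bool; true; false; _∧_; _∨_; if_then_else_)
open import Data.List using (List; []; _∷_; map; concatMap; allFin; length)
open import Data.Bool.ListAction using (any)
open import Data.List.Relation.Unary.Any using (Any)
open import Data.Product using (_×_; _,_)
open import Relation.Nullary using (¬_)
open import Relation.Nullary.Decidable using (⌊_⌋)
open import Relation.Binary.PropositionalEquality using (_≡_; _≢_)

-- successor modulo n on indices (indices 1..n of the paper are 0..n-1 here)
next : ∀ {n} → Fin n → Fin n
next {suc m} i = suc (toℕ i) mod suc m

data Kind : Set where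
  P Q R S : Kind

kinds : List Kind
kinds = P ∷ Q ∷ R ∷ S ∷ []

_==K_ : Kind → Kind → Bool
P ==K P = true
Q ==K Q = true
R ==K R = true
S ==K S = true
_ ==K _ = false

V : ℕ → Set
V n = Kind × Fin n

_==V_ : ∀ {n} → V n → V n → Bool
(k , i) ==V (l , j) = (k ==K l) ∧ ⌊ i ≟F j ⌋

vertices : (n : ℕ) → List (V n)
vertices n = concatMap (λ k → map (λ i → (k , i)) (allFin n)) kinds

data Edge (n : ℕ) : Set where
  pq  : Fin n → Edge n
  pp  : Fin n → Edge n
  qq  : Fin n → Edge n
  rq  : Fin n → Edge n
  rq' : Fin n → Edge n
  rs  : Fin n → Edge n

ends : ∀ {n} → Edge n → V n × V n
ends (pq i)  = (P , i) , (Q , i)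
ends (pp i)  = (P , i) , (P , next i)
ends (qq i)  = (Q , i) , (Q , next i)
ends (rq i)  = (R , i) , (Q , i)
ends (rq' i) = (R , i) , (Q , next i)
ends (rs i)  = (R , i) , (S , i)

edges : (n : ℕ) → List (Edge n)
edges n = concatMap (λ i → pq i ∷ pp i ∷ qq i ∷ rq i ∷ rq' i ∷ rs i ∷ []) (allFin n)

adj : ∀ {n} → V n → V n → Bool
adj {n} u v = any (λ e → match (ends e)) (edges n)
  where
  match : _ → Bool
  match (a , b) = ((a ==V u) ∧ (b ==V v)) ∨ ((a ==V v) ∧ (b ==V u))

within : ∀ {n} → ℕ → V n → V n → Bool
within zero    u v = u ==V v
within {n} (suc k) u v = within k u v ∨ any (λ w → within k u w ∧ adj w v) (vertices n)

-- least k ≤ b with within k u v (returns b if none); starting search at c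
search : ∀ {n} → ℕ → ℕ → V n → V n → ℕ
search c zero    u v = c
search c (suc b) u v = if within c u v then c else search (suc c) b u v

-- shortest-path distance d(u,v) in D^t_n (the graph has 4n vertices and is
-- connected, so the distance is the least k ≤ 4n with a walk of length ≤ k)
dist : ∀ {n} → V n → V n → ℕ
dist {n} u v = search 0 (4 * n) u v

data Elem (n : ℕ) : Set where
  vtx : V n → Elem n
  edg : Edge n → Elem n

distE : ∀ {n} → V n → Elem n → ℕ
distE x (vtx v) = dist x v
distE x (edg e) with ends e
... | (a , b) = dist x a ⊓ dist x b

IsMixedMetricGenerator : ∀ {n} → List (V n) → Set
IsMixedMetricGenerator M =
  ∀ y₁ y₂ → y₁ ≢ y₂ → Any (λ z → distE z y₁ ≢ distE z y₂) M

{-# OPTIONS --safe #-}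
-- Each r_i is closer than s_i to every vertex other than s_i, so only s_i can
-- tell r_i apart from the edge r_i s_i, and a mixed metric generator contains all
-- n pendant vertices s_i. Likewise every s_j is at least as close to q_1 as to
-- p_1, so the pair q_1, p_1 q_1 needs a further vertex: n + 1 in total.
-- Both distance comparisons come from retractions of the graph (collapse s_i onto
-- r_i, or every p_k onto q_k) that map each edge to an edge or a single vertex and
-- so cannot increase distances.
module Submission where

open import Defs
open import Data.Nat using (ℕ; zero; suc; _≤_; _+_; _*_)
open import Data.Nat.Properties using (≤-refl; ≤-trans; ≤-reflexive; n≤1+n; +-comm; m≤n⇒m⊓n≡m; m≥n⇒m⊓n≡n)
open import Data.Bool using (Bool; true; false; T; _∧_; _∨_)
open import Data.Bool.Properties using (T-∧; T-∨; ∨-comm)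
open import Data.Unit using (tt)
open import Data.Empty using (⊥-elim)
open import Data.Fin using (Fin; zero; suc)
open import Data.Fin.Properties using (injective⇒≤) renaming (_≟_ to _≟F_)
open import Data.List using (List; []; _∷_; length; lookup; map; allFin)
open import Data.List.Relation.Unary.Any as Any using (here; there; index; satisfied)
open import Data.List.Relation.Unary.Any.Properties using (any⁺; any⁻; lookup-index)
open import Data.List.Relation.Unary.Unique.Propositional using (Unique)
open import Data.List.Membership.Propositional using (_∈_; find; lose)
open import Data.List.Membership.Propositional.Properties using (∈-map⁺; ∈-concatMap⁺; ∈-allFin)
open import Data.Product using (∃; _×_; _,_; proj₁; proj₂)
open import Data.Sum using (_⊎_; inj₁; inj₂)
open import Function using (_∘_; Injective)
open import Function.Bundles using (Equivalence)
open import Relation.Nullary using (Dec; yes; no)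
open import Relation.Nullary.Decidable using (T?; map′; toWitness; fromWitness)
open import Relation.Binary.PropositionalEquality using (_≡_; _≢_; refl; sym; cong; cong₂; subst; subst₂; module ≡-Reasoning)

open Equivalence using (to; from)

private
  variable
    n : ℕ

injective∈⇒≤length : ∀ {m} {A : Set} {xs : List A} (f : Fin m → A) →
  Injective _≡_ _≡_ f → (∀ i → f i ∈ xs) → m ≤ length xs
injective∈⇒≤length {xs = xs} f f-injective f∈xs = injective⇒≤ position-injective
  where
  open ≡-Reasoning
  position-injective : Injective _≡_ _≡_ (index ∘ f∈xs)
  position-injective {i} {j} same-position = f-injective (begin
    f i                        ≡⟨ lookup-index (f∈xs i) ⟩
    lookup xs (index (f∈xs i)) ≡⟨ cong (lookup xs) same-position ⟩
    lookup xs (index (f∈xs j)) ≡⟨ lookup-index (f∈xs j) ⟨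
    f j                        ∎)

==K⇒≡ : ∀ {k l} → T (k ==K l) → k ≡ l
==K⇒≡ {P} {P} _ = refl
==K⇒≡ {Q} {Q} _ = refl
==K⇒≡ {R} {R} _ = refl
==K⇒≡ {S} {S} _ = refl
==K⇒≡ {P} {Q} ()
==K⇒≡ {P} {R} ()
==K⇒≡ {P} {S} ()
==K⇒≡ {Q} {P} ()
==K⇒≡ {Q} {R} ()
==K⇒≡ {Q} {S} ()
==K⇒≡ {R} {P} ()
==K⇒≡ {R} {Q} ()
==K⇒≡ {R} {S} ()
==K⇒≡ {S} {P} ()
==K⇒≡ {S} {Q} ()
==K⇒≡ {S} {R} ()

==K-refl : ∀ k → T (k ==K k)
==K-refl P = tt
==K-refl Q = tt
==K-refl R = tt
==K-refl S = tt

==V⇒≡ : {u v : V n} → T (u ==V v) → u ≡ v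
==V⇒≡ {u = k , i} {l , j} h with (k≡l , i≡j) ← to (T-∧ {k ==K l}) h =
  cong₂ _,_ (==K⇒≡ k≡l) (toWitness i≡j)

==V-refl : (u : V n) → T (u ==V u)
==V-refl (k , i) = from T-∧ (==K-refl k , fromWitness refl)

_≟V_ : (u v : V n) → Dec (u ≡ v)
u ≟V v = map′ ==V⇒≡ (λ { refl → ==V-refl u }) (T? (u ==V v))

∈-vertices : (u : V n) → u ∈ vertices n
∈-vertices {n} (k , i) =
  ∈-concatMap⁺ (λ k → map (k ,_) (allFin n)) (lose (∈-kinds k) (∈-map⁺ (k ,_) (∈-allFin i)))
  where
  ∈-kinds : ∀ k → k ∈ kinds
  ∈-kinds P = here refl
  ∈-kinds Q = there (here refl)
  ∈-kinds R = there (there (here refl))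
  ∈-kinds S = there (there (there (here refl)))

edges-at : Fin n → List (Edge n)
edges-at i = pq i ∷ pp i ∷ qq i ∷ rq i ∷ rq' i ∷ rs i ∷ []

∈-edges-at⇒∈-edges : {e : Edge n} (i : Fin n) → e ∈ edges-at i → e ∈ edges n
∈-edges-at⇒∈-edges i = ∈-concatMap⁺ edges-at ∘ lose (∈-allFin i)

∈-edges : (e : Edge n) → e ∈ edges n
∈-edges (pq i)  = ∈-edges-at⇒∈-edges i (here refl)
∈-edges (pp i)  = ∈-edges-at⇒∈-edges i (there (here refl))
∈-edges (qq i)  = ∈-edges-at⇒∈-edges i (there (there (here refl)))
∈-edges (rq i)  = ∈-edges-at⇒∈-edges i (there (there (there (here refl))))
∈-edges (rq' i) = ∈-edges-at⇒∈-edges i (there (there (there (there (here refl)))))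
∈-edges (rs i)  = ∈-edges-at⇒∈-edges i (there (there (there (there (there (here refl))))))

end₁ end₂ : Edge n → V n
end₁ = proj₁ ∘ ends
end₂ = proj₂ ∘ ends

adj-ends : (e : Edge n) → T (adj (end₁ e) (end₂ e))
adj-ends e =
  any⁺ _ (lose (∈-edges e) (from T-∨ (inj₁ (from T-∧ (==V-refl (end₁ e) , ==V-refl (end₂ e))))))

joins : Edge n → V n → V n → Bool
joins e a b = (end₁ e ==V a) ∧ (end₂ e ==V b)

joins⇒ends : (e : Edge n) {a b : V n} → T (joins e a b) → ends e ≡ (a , b)
joins⇒ends e h with (e₁ , e₂) ← to (T-∧ {end₁ e ==V _}) h = cong₂ _,_ (==V⇒≡ e₁) (==V⇒≡ e₂)

-- adj u v unfolds to any (adjacent-via u v) (edges n).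
adjacent-via : V n → V n → Edge n → Bool
adjacent-via u v e = joins e u v ∨ joins e v u

adj-sym : {u v : V n} → T (adj u v) → T (adj v u)
adj-sym {n} {u} {v} =
  any⁺ (adjacent-via v u) ∘ Any.map (λ {e} → flip-joins e) ∘ any⁻ (adjacent-via u v) (edges n)
  where
  flip-joins : ∀ e → T (adjacent-via u v e) → T (adjacent-via v u e)
  flip-joins e = subst T (∨-comm (joins e u v) (joins e v u))

adj⇒edge : {u v : V n} → T (adj u v) → ∃ λ e → ends e ≡ (u , v) ⊎ ends e ≡ (v , u)
adj⇒edge {n} {u} {v} h with e , uv-or-vu ← satisfied (any⁻ (adjacent-via u v) (edges n) h)
                           with to T-∨ uv-or-vu
... | inj₁ uv = e , inj₁ (joins⇒ends e uv)
... | inj₂ vu = e , inj₂ (joins⇒ends e vu)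

AdjacentOrEqual : V n → V n → Set
AdjacentOrEqual u v = u ≡ v ⊎ T (adj u v)

adjacentOrEqual-sym : {u v : V n} → AdjacentOrEqual u v → AdjacentOrEqual v u
adjacentOrEqual-sym (inj₁ u≡v) = inj₁ (sym u≡v)
adjacentOrEqual-sym {u = u} {v} (inj₂ u~v) = inj₂ (adj-sym {u = u} {v} u~v)

ImagesAdjacentOrEqual : (V n → V n) → V n × V n → Set
ImagesAdjacentOrEqual f (a , b) = AdjacentOrEqual (f a) (f b)

NonExpansive : (V n → V n) → Set
NonExpansive {n} f = (e : Edge n) → ImagesAdjacentOrEqual f (ends e)

nonExpansive-adj : {f : V n → V n} → NonExpansive f →
  {u v : V n} → T (adj u v) → AdjacentOrEqual (f u) (f v)
nonExpansive-adj {f = f} f-ne u~v with adj⇒edge u~v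
... | e , inj₁ e≡uv = subst (ImagesAdjacentOrEqual f) e≡uv (f-ne e)
... | e , inj₂ e≡vu = adjacentOrEqual-sym (subst (ImagesAdjacentOrEqual f) e≡vu (f-ne e))

nonExpansive-within : {f : V n → V n} → NonExpansive f →
  ∀ k {u v} → T (within k u v) → T (within k (f u) (f v))
nonExpansive-within {f = f} f-ne zero {u} {v} u==v with refl ← ==V⇒≡ {u = u} {v} u==v =
  ==V-refl (f u)
nonExpansive-within {n} {f} f-ne (suc k) {u} {v} h with to (T-∨ {within k u v}) h
... | inj₁ near = from T-∨ (inj₁ (nonExpansive-within f-ne k near))
... | inj₂ via with w , w-step ← satisfied (any⁻ _ (vertices n) via)
                with (u-w , w~v) ← to (T-∧ {within k u w}) w-step
                with nonExpansive-adj f-ne w~v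
... | inj₁ fw≡fv = from T-∨ (inj₁ (subst (T ∘ within k (f u)) fw≡fv (nonExpansive-within f-ne k u-w)))
... | inj₂ fw~fv = from T-∨ (inj₂ (any⁺ _ (lose (∈-vertices (f w))
                     (from T-∧ (nonExpansive-within f-ne k u-w , fw~fv)))))

search-≥ : ∀ c b (u v : V n) → c ≤ search c b u v
search-≥ c zero    u v = ≤-refl
search-≥ c (suc b) u v with within c u v
... | true  = ≤-refl
... | false = ≤-trans (n≤1+n c) (search-≥ (suc c) b u v)

search-mono : ∀ c b {u v u′ v′ : V n} → (∀ k → T (within k u v) → T (within k u′ v′)) →
  search c b u′ v′ ≤ search c b u v
search-mono c zero    h = ≤-refl
search-mono c (suc b) {u} {v} {u′} {v′} h with within c u v in uv | within c u′ v′ in u′v′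
... | true  | true  = ≤-refl
... | true  | false = ⊥-elim (subst T u′v′ (h c (subst T (sym uv) tt)))
... | false | true  = ≤-trans (n≤1+n c) (search-≥ (suc c) b u v)
... | false | false = search-mono (suc c) b h

nonExpansive-dist-≤ : {f : V n → V n} → NonExpansive f →
  (u v : V n) → dist (f u) (f v) ≤ dist u v
nonExpansive-dist-≤ {n} f-ne u v = search-mono 0 (4 * n) (λ k → nonExpansive-within f-ne k)

collapse-s : Fin n → V n → V n
collapse-s i₀ (S , i) with i ≟F i₀
... | yes _ = R , i
... | no  _ = S , i
collapse-s i₀ u = u

collapse-s-nonExpansive : (i₀ : Fin n) → NonExpansive (collapse-s i₀)
collapse-s-nonExpansive i₀ (pq i)  = inj₂ (adj-ends (pq i))
collapse-s-nonExpansive i₀ (pp i)  = inj₂ (adj-ends (pp i))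
collapse-s-nonExpansive i₀ (qq i)  = inj₂ (adj-ends (qq i))
collapse-s-nonExpansive i₀ (rq i)  = inj₂ (adj-ends (rq i))
collapse-s-nonExpansive i₀ (rq' i) = inj₂ (adj-ends (rq' i))
collapse-s-nonExpansive i₀ (rs i) with i ≟F i₀
... | yes _ = inj₁ refl
... | no  _ = inj₂ (adj-ends (rs i))

collapse-s-fixes : (i₀ : Fin n) {u : V n} → u ≢ (S , i₀) → collapse-s i₀ u ≡ u
collapse-s-fixes i₀ {P , i} _ = refl
collapse-s-fixes i₀ {Q , i} _ = refl
collapse-s-fixes i₀ {R , i} _ = refl
collapse-s-fixes i₀ {S , i} u≢s with i ≟F i₀
... | yes refl = ⊥-elim (u≢s refl)
... | no  _    = refl

collapse-s-hits : (i₀ : Fin n) → collapse-s i₀ (S , i₀) ≡ (R , i₀)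
collapse-s-hits i₀ with i₀ ≟F i₀
... | yes _     = refl
... | no  i₀≢i₀ = ⊥-elim (i₀≢i₀ refl)

collapse-p : V n → V n
collapse-p (P , i) = Q , i
collapse-p u       = u

collapse-p-nonExpansive : NonExpansive (collapse-p {n})
collapse-p-nonExpansive (pq i)  = inj₁ refl
collapse-p-nonExpansive (pp i)  = inj₂ (adj-ends (qq i))
collapse-p-nonExpansive (qq i)  = inj₂ (adj-ends (qq i))
collapse-p-nonExpansive (rq i)  = inj₂ (adj-ends (rq i))
collapse-p-nonExpansive (rq' i) = inj₂ (adj-ends (rq' i))
collapse-p-nonExpansive (rs i)  = inj₂ (adj-ends (rs i))

collapse-p-fixes : {u : V n} → proj₁ u ≢ P → collapse-p u ≡ u
collapse-p-fixes {u = P , i} k≢P = ⊥-elim (k≢P refl)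
collapse-p-fixes {u = Q , i} _   = refl
collapse-p-fixes {u = R , i} _   = refl
collapse-p-fixes {u = S , i} _   = refl

dist-r≤dist-s : {z : V n} (i : Fin n) → z ≢ (S , i) → dist z (R , i) ≤ dist z (S , i)
dist-r≤dist-s {z = z} i z≢s =
  subst₂ (λ a b → dist a b ≤ dist z (S , i)) (collapse-s-fixes i z≢s) (collapse-s-hits i)
    (nonExpansive-dist-≤ (collapse-s-nonExpansive i) z (S , i))

dist-q≤dist-p : {z : V n} (i : Fin n) → proj₁ z ≢ P → dist z (Q , i) ≤ dist z (P , i)
dist-q≤dist-p {z = z} i z≢p =
  subst (λ a → dist a (Q , i) ≤ dist z (P , i)) (collapse-p-fixes z≢p)
    (nonExpansive-dist-≤ collapse-p-nonExpansive z (P , i))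

pendant∈generator : {M : List (V n)} → IsMixedMetricGenerator M → (i : Fin n) → (S , i) ∈ M
pendant∈generator gen i
  with z , z∈M , z-resolves ← find (gen (vtx (R , i)) (edg (rs i)) (λ ()))
  with z ≟V (S , i)
... | yes refl = z∈M
... | no  z≢s  = ⊥-elim (z-resolves (sym (m≤n⇒m⊓n≡m (dist-r≤dist-s i z≢s))))

non-pendant∈generator : {M : List (V n)} → IsMixedMetricGenerator M → Fin n →
  ∃ λ z → z ∈ M × ∀ j → z ≢ (S , j)
non-pendant∈generator gen i
  with z , z∈M , z-resolves ← find (gen (vtx (Q , i)) (edg (pq i)) (λ ())) =
  z , z∈M , λ { j refl → z-resolves (sym (m≥n⇒m⊓n≡n (dist-q≤dist-p i λ ()))) }

lemma3 : (n : ℕ) → 4 ≤ n → (M : List (V n)) → Unique M →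
    IsMixedMetricGenerator M → n + 1 ≤ length M
lemma3 (suc m) _ M _ gen with z , z∈M , z≢s ← non-pendant∈generator gen zero =
  ≤-trans (≤-reflexive (+-comm (suc m) 1)) (injective∈⇒≤length witness witness-injective witness∈M)
  where
  witness : Fin (suc (suc m)) → V (suc m)
  witness zero    = z
  witness (suc i) = S , i

  witness-injective : Injective _≡_ _≡_ witness
  witness-injective {zero}  {zero}  _    = refl
  witness-injective {zero}  {suc j} z≡s  = ⊥-elim (z≢s j z≡s)
  witness-injective {suc i} {zero}  s≡z  = ⊥-elim (z≢s i (sym s≡z))
  witness-injective {suc i} {suc j} s≡s  = cong (suc ∘ proj₂) s≡s

  witness∈M : ∀ i → witness i ∈ M
  witness∈M zero    = z∈M
  witness∈M (suc i) = pendant∈generator gen i
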